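{- Let $m,n$ be positive integers and $\mathcal G_1,\mathcal G_2$ classes of graphs. If no graph in $\mathcal G_1$ has a $K_{2,m}$-minor and no graph in $\mathcal G_2$ has a $K_{2,n}$-minor, then no graph in $\mathcal G_1\oplus\mathcal G_2$ has a $K_{2,mn}$-minor.
   Context: Graphs are finite and simple. 2-sum: for disjoint graphs $G_1,G_2$ and, for $i=1,2$, a vertex $z_i$ of $G_i$ incident with exactly two edges $x_iz_i,y_iz_i$, let $G_i'=G_i\setminus z_i$ if $x_iy_i\notin E(G_i)$ and $G_i'=G_i\setminus z_i\setminus x_iy_i$ otherwise; the 2-sum over $z_1,z_2$ is obtained from $G_1',G_2'$ by identifying $x_1$ with $x_2$ and $y_1$ with $y_2$ and then, if $x_iy_i\in E(G_i)$ for at least one $i$, adding an edge between the two identified vertices. This extends to 2-summing one graph $G_1$ with several graphs $G_2^1,\dots,G_2^t$, each having a degree-two vertex, over $t$ pairwise nonadjacent degree-two vertices of $G_1$. $\mathcal G_1\oplus\mathcal G_2$ is the class of all graphs obtained by 2-summing one graph of $\mathcal G_1$ with several graphs of $\mathcal G_2$. -}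

module Defs where

open import Data.Nat using (ℕ; zero; suc; _+_; _*_; _<ᵇ_; _≤_)
open import Data.Fin using (Fin; zero; suc; toℕ; _≟_)
open import Data.Bool using (Bool; true; false; not; _∧_; _∨_; _xor_; T)
open import Data.Bool.Properties using (xor-comm; xor-same)
open import Data.Maybe using (Maybe; just)
open import Data.Product using (Σ; ∃; ∃₂; _×_; _,_)
open import Data.Sum using (_⊎_)
open import Function using (_∘_)
open import Relation.Nullary using (¬_; does; yes; no)
open import Relation.Binary.PropositionalEquality using (_≡_; _≢_; refl)

record Graph : Set where
  field
    n     : ℕ
    adj   : Fin n → Fin n → Bool
    sym   : ∀ u v → adj u v ≡ adj v u
    irref : ∀ v → adj v v ≡ false

open Graph public

_==_ : ∀ {k} → Fin k → Fin k → Bool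
a == b = does (a ≟ b)

anyF : ∀ {t} → (Fin t → Bool) → Bool
anyF {zero}  f = false
anyF {suc t} f = f zero ∨ anyF (f ∘ suc)

-- Paths in G from u to v all of whose vertices after u satisfy P.
data Path (G : Graph) (P : Fin (n G) → Set) : Fin (n G) → Fin (n G) → Set where
  here : ∀ {u} → Path G P u u
  step : ∀ {u v w} → adj G u v ≡ true → P v → Path G P v w → Path G P u w

-- A model of H in G: br v = just i means v lies in the branch set of i
-- (branch sets are therefore pairwise disjoint); each branch set is
-- nonempty and connected, and every edge of H is realised by an edge of G
-- between the corresponding branch sets.
record Model (H G : Graph) : Set where
  field
    br        : Fin (n G) → Maybe (Fin (n H))
    nonempty  : ∀ i → ∃ λ v → br v ≡ just i
    connected : ∀ i u v → br u ≡ just i → br v ≡ just i →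
                Path G (λ w → br w ≡ just i) u v
    edges     : ∀ i j → adj H i j ≡ true →
                ∃₂ λ u v → br u ≡ just i × br v ≡ just j × adj G u v ≡ true

HasMinor : Graph → Graph → Set
HasMinor G H = Model H G

-- The complete bipartite graph K_{2,m}: vertices 0,1 on one side,
-- 2,…,m+1 on the other.
side : ∀ {k} → Fin k → Bool
side i = toℕ i <ᵇ 2

K2 : ℕ → Graph
K2 m = record
  { n     = 2 + m
  ; adj   = λ i j → side i xor side j
  ; sym   = λ i j → xor-comm (side i) (side j)
  ; irref = λ i → xor-same (side i)
  }

DegTwo : (G : Graph) → (z x y : Fin (n G)) → Set
DegTwo G z x y =
  x ≢ y × adj G x z ≡ true × adj G y z ≡ true ×
  (∀ w → adj G w z ≡ true → w ≡ x ⊎ w ≡ y)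

-- Data for 2-summing G1 with G2 j (j < t) over the pairwise distinct,
-- pairwise nonadjacent degree-two vertices z j of G1 and the degree-two
-- vertices w j of G2 j, identifying x1 j with x2 j and y1 j with y2 j.
record TwoSumData : Set where
  field
    G1  : Graph
    t   : ℕ
    z   : Fin t → Fin (n G1)
    x1  : Fin t → Fin (n G1)
    y1  : Fin t → Fin (n G1)
    deg1 : ∀ j → DegTwo G1 (z j) (x1 j) (y1 j)
    z-distinct : ∀ j k → j ≢ k → z j ≢ z k
    z-nonadj   : ∀ j k → adj G1 (z j) (z k) ≡ false
    G2  : Fin t → Graph
    w   : ∀ j → Fin (n (G2 j))
    x2  : ∀ j → Fin (n (G2 j))
    y2  : ∀ j → Fin (n (G2 j))
    deg2 : ∀ j → DegTwo (G2 j) (w j) (x2 j) (y2 j)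

module _ (d : TwoSumData) where
  open TwoSumData d

  isZ : Fin (n G1) → Bool
  isZ v = anyF (λ j → z j == v)

  inner : ∀ j → Fin (n (G2 j)) → Bool
  inner j u = not (u == w j) ∧ not (u == x2 j) ∧ not (u == y2 j)

  SumV : Set
  SumV = Σ (Fin (n G1)) (λ v → T (not (isZ v)))
       ⊎ Σ (Fin t) (λ j → Σ (Fin (n (G2 j))) (λ u → T (inner j u)))

  adj11 : Fin (n G1) → Fin (n G1) → Bool
  adj11 a b = adj G1 a b ∨
    anyF (λ j → (((a == x1 j) ∧ (b == y1 j)) ∨ ((a == y1 j) ∧ (b == x1 j)))
                ∧ adj (G2 j) (x2 j) (y2 j))

  adj12 : Fin (n G1) → (j : Fin t) → Fin (n (G2 j)) → Bool
  adj12 a j u = ((a == x1 j) ∧ adj (G2 j) (x2 j) u)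
              ∨ ((a == y1 j) ∧ adj (G2 j) (y2 j) u)

  adj22 : (j k : Fin t) → Fin (n (G2 j)) → Fin (n (G2 k)) → Bool
  adj22 j k u u' with j ≟ k
  ... | yes refl = adj (G2 j) u u'
  ... | no _     = false

  sumAdj : SumV → SumV → Bool
  sumAdj (Data.Sum.inj₁ (a , _)) (Data.Sum.inj₁ (b , _)) = adj11 a b
  sumAdj (Data.Sum.inj₁ (a , _)) (Data.Sum.inj₂ (k , u , _)) = adj12 a k u
  sumAdj (Data.Sum.inj₂ (j , u , _)) (Data.Sum.inj₁ (b , _)) = adj12 b j u
  sumAdj (Data.Sum.inj₂ (j , u , _)) (Data.Sum.inj₂ (k , u' , _)) = adj22 j k u u'

record IsTwoSum (G : Graph) (d : TwoSumData) : Set where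
  field
    to      : Fin (n G) → SumV d
    from    : SumV d → Fin (n G)
    from-to : ∀ a → from (to a) ≡ a
    to-from : ∀ s → to (from s) ≡ s
    adj-to  : ∀ a b → adj G a b ≡ sumAdj d (to a) (to b)

Class : Set₁
Class = Graph → Set

_⊕_ : Class → Class → Class
(𝒢₁ ⊕ 𝒢₂) G = Σ TwoSumData λ d →
  𝒢₁ (TwoSumData.G1 d) × (∀ j → 𝒢₂ (TwoSumData.G2 d j)) × IsTwoSum G d

module Submission where

-- We prove the positive form K2-minor-in-part: a model of K_{2,mq} in a
-- 2-sum G of G1 with pieces G2 j yields a model of K_{2,m} in G1 or of
-- K_{2,q} in some piece.  Each leaf of K_{2,mq} gets a slot in G1: a vertex of
-- G1 in its branch set, or z j if its branch set lies inside piece j.  If a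
-- pole is trapped inside a piece, all but at most two leaves lie in that
-- piece, and projecting the model into the piece gives K_{2,q}.  Otherwise the
-- pigeonhole principle on slots gives q leaves sharing a slot z j (project
-- into piece j) or m leaves with distinct slots (project into G1, contracting
-- each piece onto the cherry x1 j – z j – y1 j).  The degenerate cases m = 1,
-- q = 1 and t = 0 (no pieces) use that a vertex of degree two already gives a
-- K_{2,1}-minor.

open import Defs hiding (sym)
open import Data.Nat using (ℕ; zero; suc; _+_; _*_; _≤_; z≤n; s≤s)
open import Data.Fin using (Fin; zero; suc; _≟_)
open import Data.Bool using (Bool; true; false; not; _∧_; _∨_; T; if_then_else_)
open import Data.Bool.Properties using (∧-conicalˡ; ∧-conicalʳ; ∨-zeroʳ; not-injective; T-irrelevant)
open import Data.Maybe using (Maybe; just; nothing)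
open import Data.Maybe.Properties using (just-injective)
import Data.Maybe.Properties as Maybe
open import Data.Product using (Σ; ∃; ∃₂; _×_; _,_; proj₁; proj₂)
open import Data.Sum using (_⊎_; inj₁; inj₂)
open import Data.Unit using (tt)
open import Data.Empty using (⊥; ⊥-elim)
open import Function using (_∘_)
import Data.Nat.Properties as ℕ
import Data.Fin.Properties as Fin
open import Relation.Nullary using (¬_; Dec; does; yes; no)
open import Relation.Nullary.Decidable using (dec-true; dec-false; T?)
open import Relation.Binary.PropositionalEquality
  using (_≡_; _≢_; refl; sym; trans; cong; subst)

==⇒≡ : ∀ {k} {a b : Fin k} → (a == b) ≡ true → a ≡ b
==⇒≡ {a = a} {b} e with a ≟ b
... | yes a≡b = a≡b

==-refl : ∀ {k} (a : Fin k) → (a == a) ≡ true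
==-refl a = dec-true (a ≟ a) refl

≢⇒==false : ∀ {k} {a b : Fin k} → a ≢ b → (a == b) ≡ false
≢⇒==false {a = a} {b} = dec-false (a ≟ b)

==false⇒≢ : ∀ {k} {a b : Fin k} → (a == b) ≡ false → a ≢ b
==false⇒≢ {a = a} e refl with () ← trans (sym e) (==-refl a)

_=M_ : ∀ {k} → Maybe (Fin k) → Maybe (Fin k) → Bool
a =M b = does (Maybe.≡-dec _≟_ a b)

=M⇒≡ : ∀ {k} {a b : Maybe (Fin k)} → (a =M b) ≡ true → a ≡ b
=M⇒≡ {a = a} {b} e with Maybe.≡-dec _≟_ a b
... | yes a≡b = a≡b

=M-refl : ∀ {k} (a : Maybe (Fin k)) → (a =M a) ≡ true
=M-refl a = dec-true (Maybe.≡-dec _≟_ a a) refl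

≢⇒=Mfalse : ∀ {k} {a b : Maybe (Fin k)} → a ≢ b → (a =M b) ≡ false
≢⇒=Mfalse {a = a} {b} = dec-false (Maybe.≡-dec _≟_ a b)

=Mfalse⇒≢ : ∀ {k} {a b : Maybe (Fin k)} → (a =M b) ≡ false → a ≢ b
=Mfalse⇒≢ {a = a} e refl with () ← trans (sym e) (=M-refl a)

anyF-witness : ∀ {t} (f : Fin t → Bool) → anyF f ≡ true → ∃ λ j → f j ≡ true
anyF-witness {suc t} f e with f zero in f0
... | true = zero , f0
... | false with j , fj ← anyF-witness (f ∘ suc) e = suc j , fj

anyF-intro : ∀ {t} (f : Fin t → Bool) j → f j ≡ true → anyF f ≡ true
anyF-intro f zero e rewrite e = refl
anyF-intro f (suc j) e with f zero
... | true = refl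
... | false = anyF-intro (f ∘ suc) j e

anyF-none : ∀ {t} (f : Fin t → Bool) → (∀ j → f j ≡ false) → anyF f ≡ false
anyF-none {zero} f none = refl
anyF-none {suc t} f none rewrite none zero = anyF-none (f ∘ suc) (none ∘ suc)

anyF-false : ∀ {t} (f : Fin t → Bool) → anyF f ≡ false → ∀ j → f j ≡ false
anyF-false f e j with f j in fj
... | false = refl
... | true with () ← trans (sym (anyF-intro f j fj)) e

find : ∀ {t} → (Fin t → Bool) → Maybe (Fin t)
find {zero} f = nothing
find {suc t} f with f zero | find (f ∘ suc)
... | true  | _      = just zero
... | false | just j = just (suc j)
... | false | nothing = nothing

find-just : ∀ {t} (f : Fin t → Bool) {j} → find f ≡ just j → f j ≡ true
find-just {suc t} f e with f zero in f0 | find (f ∘ suc) in rest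
find-just {suc t} f refl | true  | _      = f0
find-just {suc t} f refl | false | just j = find-just (f ∘ suc) rest

find-nothing : ∀ {t} (f : Fin t → Bool) → find f ≡ nothing → ∀ j → f j ≡ false
find-nothing {suc t} f e j with f zero in f0 | find (f ∘ suc) in rest
find-nothing {suc t} f e zero    | false | nothing = f0
find-nothing {suc t} f e (suc j) | false | nothing = find-nothing (f ∘ suc) rest j

count : ∀ {N} → (Fin N → Bool) → ℕ
count {zero}  P = 0
count {suc N} P = (if P zero then suc else (λ c → c)) (count (P ∘ suc))

count-all : ∀ N → count {N} (λ _ → true) ≡ N
count-all zero    = refl
count-all (suc N) = cong suc (count-all N)

count-none : ∀ {N} (P : Fin N → Bool) → (∀ i → P i ≡ false) → count P ≡ 0
count-none {zero}  P none = refl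
count-none {suc N} P none rewrite none zero = count-none (P ∘ suc) (none ∘ suc)

count-mono : ∀ {N} (P Q : Fin N → Bool) → (∀ i → P i ≡ true → Q i ≡ true) →
             count P ≤ count Q
count-mono {zero} P Q P⇒Q = z≤n
count-mono {suc N} P Q P⇒Q with P zero in p0 | Q zero in q0
... | true  | true  = s≤s (count-mono (P ∘ suc) (Q ∘ suc) (P⇒Q ∘ suc))
... | false | true  = ℕ.m≤n⇒m≤1+n (count-mono (P ∘ suc) (Q ∘ suc) (P⇒Q ∘ suc))
... | false | false = count-mono (P ∘ suc) (Q ∘ suc) (P⇒Q ∘ suc)
... | true  | false with () ← trans (sym (P⇒Q zero p0)) q0

count-∨ : ∀ {N} (P Q : Fin N → Bool) → count (λ i → P i ∨ Q i) ≤ count P + count Q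
count-∨ {zero} P Q = z≤n
count-∨ {suc N} P Q with P zero | Q zero | count-∨ (P ∘ suc) (Q ∘ suc)
... | true  | true  | ih = s≤s (ℕ.≤-trans ih (ℕ.+-monoʳ-≤ (count (P ∘ suc)) (ℕ.n≤1+n _)))
... | true  | false | ih = s≤s ih
... | false | true  | ih = ℕ.≤-trans (s≤s ih) (ℕ.≤-reflexive (sym (ℕ.+-suc _ _)))
... | false | false | ih = ih

count-unique : ∀ {N} (P : Fin N → Bool) →
               (∀ a b → P a ≡ true → P b ≡ true → a ≡ b) → count P ≤ 1
count-unique {zero} P unique = z≤n
count-unique {suc N} P unique with P zero in p0
... | true = ℕ.≤-reflexive (cong suc (count-none (P ∘ suc) only-zero))
  where
  only-zero : ∀ i → P (suc i) ≡ false
  only-zero i with P (suc i) in pi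
  ... | false = refl
  ... | true with () ← unique zero (suc i) p0 pi
... | false = count-unique (P ∘ suc) λ a b pa pb → Fin.suc-injective (unique (suc a) (suc b) pa pb)

select : ∀ {N} (P : Fin N → Bool) k → k ≤ count P →
         Σ (Fin k → Fin N) λ e → (∀ a b → e a ≡ e b → a ≡ b) × (∀ r → P (e r) ≡ true)
select P zero _ = (λ ()) , (λ ()) , (λ ())
select {suc N} P (suc k) k≤ with P zero in p0
... | false = let e , e-inj , e-P = select (P ∘ suc) (suc k) k≤
              in suc ∘ e , (λ a b eq → e-inj a b (Fin.suc-injective eq)) , e-P
... | true = e′ , e′-inj , e′-P
  where
  rest : Σ (Fin k → Fin N) λ e → (∀ a b → e a ≡ e b → a ≡ b) × (∀ r → P (suc (e r)) ≡ true)
  rest = select (P ∘ suc) k (ℕ.≤-pred k≤)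
  e′ : Fin (suc k) → Fin (suc N)
  e′ zero    = zero
  e′ (suc r) = suc (proj₁ rest r)
  e′-inj : ∀ a b → e′ a ≡ e′ b → a ≡ b
  e′-inj zero    zero    _  = refl
  e′-inj (suc a) (suc b) eq = cong suc (proj₁ (proj₂ rest) a b (Fin.suc-injective eq))
  e′-P : ∀ r → P (e′ r) ≡ true
  e′-P zero    = p0
  e′-P (suc r) = proj₂ (proj₂ rest) r

module _ {N K : ℕ} (κ : Fin N → Fin K) (q : ℕ) (q≥1 : 1 ≤ q) where

  ColourClass : (Fin N → Bool) → Fin K → Fin N → Bool
  ColourClass D c i = D i ∧ (κ i == c)

  Rainbow : ℕ → (Fin N → Bool) → Set
  Rainbow m D = Σ (Fin m → Fin N) λ h →
    (∀ a b → κ (h a) ≡ κ (h b) → a ≡ b) × (∀ r → D (h r) ≡ true)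

  without : (Fin N → Bool) → Fin K → Fin N → Bool
  without D c i = D i ∧ not (κ i == c)

  split-class : ∀ D c → count D ≤ count (ColourClass D c) + count (without D c)
  split-class D c =
    ℕ.≤-trans (count-mono D _ either) (count-∨ (ColourClass D c) (without D c))
    where
    either : ∀ i → D i ≡ true → (ColourClass D c i ∨ without D c i) ≡ true
    either i Di rewrite Di with κ i == c
    ... | true  = refl
    ... | false = refl

  class-without : ∀ D c₀ c → count (ColourClass (without D c₀) c) ≤ count (ColourClass D c)
  class-without D c₀ c = count-mono _ _ shrink
    where
    shrink : ∀ i → ColourClass (without D c₀) c i ≡ true → ColourClass D c i ≡ true
    shrink i e with D i | κ i == c₀ | κ i == c
    ... | true | false | true = refl

  rainbow-extend : ∀ m D i₀ → D i₀ ≡ true → Rainbow m (without D (κ i₀)) → Rainbow (suc m) D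
  rainbow-extend m D i₀ Di₀ (h , h-rainbow , h-D′) = h′ , h′-rainbow , h′-D
    where
    h′ : Fin (suc m) → Fin N
    h′ zero    = i₀
    h′ (suc r) = h r
    new-colour : ∀ r → κ (h r) ≢ κ i₀
    new-colour r = ==false⇒≢ (not-injective (∧-conicalʳ (D (h r)) _ (h-D′ r)))
    h′-rainbow : ∀ a b → κ (h′ a) ≡ κ (h′ b) → a ≡ b
    h′-rainbow zero    zero    _  = refl
    h′-rainbow zero    (suc b) eq = ⊥-elim (new-colour b (sym eq))
    h′-rainbow (suc a) zero    eq = ⊥-elim (new-colour a eq)
    h′-rainbow (suc a) (suc b) eq = cong suc (h-rainbow a b eq)
    h′-D : ∀ r → D (h′ r) ≡ true
    h′-D zero    = Di₀
    h′-D (suc r) = ∧-conicalˡ (D (h r)) _ (h-D′ r)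

  -- Induction on m: pick i₀ ∈ D; if its colour class is small, remove it and
  -- recurse on the remaining at least m·q elements.
  pigeonhole : ∀ m D → m * q ≤ count D → (∃ λ c → q ≤ count (ColourClass D c)) ⊎ Rainbow m D
  pigeonhole zero D _ = inj₂ ((λ ()) , (λ ()) , (λ ()))
  pigeonhole (suc m) D big
    with i₀ , _ , Di₀ ← select D 1 (ℕ.≤-trans (ℕ.≤-trans q≥1 (ℕ.m≤m+n q (m * q))) big)
    with q ℕ.≤? count (ColourClass D (κ (i₀ zero)))
  ... | yes class-big = inj₁ (κ (i₀ zero) , class-big)
  ... | no class-small with pigeonhole m (without D (κ (i₀ zero))) rest-big
    where
    rest-big : m * q ≤ count (without D (κ (i₀ zero)))
    rest-big = ℕ.+-cancelˡ-≤ q _ _ (ℕ.≤-trans big (ℕ.≤-trans (split-class D (κ (i₀ zero)))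
                 (ℕ.+-monoˡ-≤ _ (ℕ.<⇒≤ (ℕ.≰⇒> class-small)))))
  ...   | inj₁ (c , many) = inj₁ (c , ℕ.≤-trans many (class-without D (κ (i₀ zero)) c))
  ...   | inj₂ rainbow    = inj₂ (rainbow-extend m D (i₀ zero) (Di₀ zero) rainbow)

module _ {G : Graph} {R : Fin (n G) → Set} where

  _++ᴾ_ : ∀ {u v w} → Path G R u v → Path G R v w → Path G R u w
  here         ++ᴾ q = q
  step e Rv p  ++ᴾ q = step e Rv (p ++ᴾ q)

  reverse : ∀ {u v} → R u → Path G R u v → Path G R v u
  reverse Ru here = here
  reverse Ru (step {v = v} e Rv p) = reverse Rv p ++ᴾ step (trans (Graph.sym G v _) e) Ru here

  ≡⇒path : ∀ {u v} → u ≡ v → Path G R u v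
  ≡⇒path refl = here

  edge-path : ∀ {u v} → adj G u v ≡ true → R v → Path G R u v
  edge-path e Rv = step e Rv here

OneOf : ∀ {A : Set} → A → A → A → A → Set
OneOf p q c a = a ≡ p ⊎ a ≡ q ⊎ a ≡ c

-- Both projections of a model collapse a piece of the 2-sum onto such a
-- cherry (x – w – y, resp. x – z – y).
cherry-path : ∀ {G : Graph} {R : Fin (n G) → Set} (p q c : Fin (n G)) →
  adj G c p ≡ true → adj G c q ≡ true → (R p → R q → R c) →
  ∀ a b → OneOf p q c a → OneOf p q c b → R a → R b → Path G R a b
cherry-path {G} {R} p q c cp cq centre = go
  where
  pc : adj G p c ≡ true
  pc = trans (Graph.sym G p c) cp
  qc : adj G q c ≡ true
  qc = trans (Graph.sym G q c) cq
  go : ∀ a b → OneOf p q c a → OneOf p q c b → R a → R b → Path G R a b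
  go a b (inj₁ refl)        (inj₁ refl)        Ra Rb = here
  go a b (inj₁ refl)        (inj₂ (inj₁ refl)) Ra Rb = step pc (centre Ra Rb) (edge-path cq Rb)
  go a b (inj₁ refl)        (inj₂ (inj₂ refl)) Ra Rb = edge-path pc Rb
  go a b (inj₂ (inj₁ refl)) (inj₁ refl)        Ra Rb = step qc (centre Rb Ra) (edge-path cp Rb)
  go a b (inj₂ (inj₁ refl)) (inj₂ (inj₁ refl)) Ra Rb = here
  go a b (inj₂ (inj₁ refl)) (inj₂ (inj₂ refl)) Ra Rb = edge-path qc Rb
  go a b (inj₂ (inj₂ refl)) (inj₁ refl)        Ra Rb = edge-path cp Rb
  go a b (inj₂ (inj₂ refl)) (inj₂ (inj₁ refl)) Ra Rb = edge-path cq Rb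
  go a b (inj₂ (inj₂ refl)) (inj₂ (inj₂ refl)) Ra Rb = here

-- Both halves of
-- the main argument (into G1, into a piece G2 j) are instances.
module _ {H G H′ G′ : Graph} (M : Model H G) (g : Fin (n H′) → Fin (n H)) where
  open Model M

  record Projection : Set where
    field
      image   : Fin (n G) → Fin (n G′)
      branch′ : Fin (n G′) → Maybe (Fin (n H′))
      image-in-branch : ∀ v i → br v ≡ just (g i) → branch′ (image v) ≡ just i
      branch-reached : ∀ v′ i → branch′ v′ ≡ just i →
        ∃ λ v → br v ≡ just (g i) × Path G′ (λ w → branch′ w ≡ just i) (image v) v′
      inner-edge : ∀ u v i → br u ≡ just (g i) → br v ≡ just (g i) → adj G u v ≡ true →
        Path G′ (λ w → branch′ w ≡ just i) (image u) (image v)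
      cross-edge : ∀ u v i j → br u ≡ just (g i) → br v ≡ just (g j) → adj G u v ≡ true →
        adj H′ i j ≡ true →
        ∃₂ λ u′ v′ → branch′ u′ ≡ just i × branch′ v′ ≡ just j × adj G′ u′ v′ ≡ true

  projected-model : (∀ i j → adj H′ i j ≡ true → adj H (g i) (g j) ≡ true) →
                    Projection → Model H′ G′
  projected-model g-adj π = record
    { br        = branch′
    ; nonempty  = λ i → let v , v∈ = nonempty (g i) in image v , image-in-branch v i v∈
    ; connected = λ i u′ v′ u′∈ v′∈ →
        let a , a∈ , a⇝u′ = branch-reached u′ i u′∈
            b , b∈ , b⇝v′ = branch-reached v′ i v′∈
        in reverse (image-in-branch a i a∈) a⇝u′
             ++ᴾ (image-path i a∈ (connected (g i) a b a∈ b∈) ++ᴾ b⇝v′)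
    ; edges     = λ i j ij →
        let u , v , u∈ , v∈ , uv = edges (g i) (g j) (g-adj i j ij)
        in cross-edge u v i j u∈ v∈ uv ij
    }
    where
    open Projection π
    image-path : ∀ i {u v} → br u ≡ just (g i) → Path G (λ w → br w ≡ just (g i)) u v →
                 Path G′ (λ w → branch′ w ≡ just i) (image u) (image v)
    image-path i u∈ here = here
    image-path i u∈ (step e v∈ p) = inner-edge _ _ i u∈ v∈ e ++ᴾ image-path i v∈ p

-- An injection h of m leaves into N leaves extends to
-- an adjacency-preserving embedding of K_{2,m} into K_{2,N} fixing the two
-- poles 0 and 1; restrict is its partial inverse, used to turn branch
-- assignments for K_{2,N} into ones for K_{2,m}.

leaf : ∀ {N} → Fin N → Fin (2 + N)
leaf k = suc (suc k)

pole-leaf-adj : ∀ {N} (k : Fin N) → adj (K2 N) zero (leaf k) ≡ true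
pole-leaf-adj k = refl

pole′-leaf-adj : ∀ {N} (k : Fin N) → adj (K2 N) (suc zero) (leaf k) ≡ true
pole′-leaf-adj k = refl

module LeafEmbedding {m N : ℕ} (h : Fin m → Fin N) (h-inj : ∀ a b → h a ≡ h b → a ≡ b) where

  embed : Fin (2 + m) → Fin (2 + N)
  embed zero          = zero
  embed (suc zero)    = suc zero
  embed (suc (suc r)) = leaf (h r)

  side-embed : ∀ i → side (embed i) ≡ side i
  side-embed zero          = refl
  side-embed (suc zero)    = refl
  side-embed (suc (suc r)) = refl

  embed-adj : ∀ i j → adj (K2 m) i j ≡ true → adj (K2 N) (embed i) (embed j) ≡ true
  embed-adj i j ij rewrite side-embed i | side-embed j = ij

  preimage : Fin N → Maybe (Fin m)
  preimage k = find (λ r → h r == k)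

  preimage-h : ∀ r → preimage (h r) ≡ just r
  preimage-h r with find (λ r′ → h r′ == h r) in found
  ... | just r′ = cong just (h-inj r′ r (==⇒≡ (find-just (λ r′ → h r′ == h r) found)))
  ... | nothing with () ← trans (sym (find-nothing _ found r)) (==-refl (h r))

  restrict-vertex : Fin (2 + N) → Maybe (Fin (2 + m))
  restrict-vertex zero             = just zero
  restrict-vertex (suc zero)       = just (suc zero)
  restrict-vertex (suc (suc k)) with preimage k
  ... | just r  = just (suc (suc r))
  ... | nothing = nothing

  restrict : Maybe (Fin (2 + N)) → Maybe (Fin (2 + m))
  restrict nothing  = nothing
  restrict (just i) = restrict-vertex i

  restrict-embed : ∀ i → restrict (just (embed i)) ≡ just i
  restrict-embed zero          = refl
  restrict-embed (suc zero)    = refl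
  restrict-embed (suc (suc r)) rewrite preimage-h r = refl

  restrict⇒embed : ∀ b i → restrict b ≡ just i → b ≡ just (embed i)
  restrict⇒embed (just zero)       zero       refl = refl
  restrict⇒embed (just (suc zero)) (suc zero) refl = refl
  restrict⇒embed (just (suc (suc k))) i e with preimage k in found
  restrict⇒embed (just (suc (suc k))) .(suc (suc r)) refl | just r =
    cong (λ x → just (leaf x)) (sym (==⇒≡ (find-just (λ r′ → h r′ == k) found)))

  embed-injective : ∀ i j → embed i ≡ embed j → i ≡ j
  embed-injective i j e =
    just-injective (trans (sym (restrict-embed i)) (trans (cong (restrict ∘ just) e) (restrict-embed j)))

adjacent⇒≢ : ∀ (G : Graph) {a b} → adj G a b ≡ true → a ≢ b
adjacent⇒≢ G {a} ab refl with () ← trans (sym ab) (Graph.irref G a)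

-- A vertex z of degree two with neighbours x ≠ y gives a K_{2,1}-minor with
-- branch sets {x}, {y}, {z}.  This settles the degenerate cases m = 1 and
-- q = 1 of the main argument, as G1 and every G2 j have such a vertex.
module DegreeTwo (G : Graph) (z x y : Fin (n G)) (deg : DegTwo G z x y) where
  private
    x≢y : x ≢ y
    x≢y = proj₁ deg
    xz : adj G x z ≡ true
    xz = proj₁ (proj₂ deg)
    yz : adj G y z ≡ true
    yz = proj₁ (proj₂ (proj₂ deg))
    zx : adj G z x ≡ true
    zx = trans (Graph.sym G z x) xz
    zy : adj G z y ≡ true
    zy = trans (Graph.sym G z y) yz

  corner : Fin 3 → Fin (n G)
  corner zero             = x
  corner (suc zero)       = y
  corner (suc (suc zero)) = z

  branch : Fin (n G) → Maybe (Fin 3)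
  branch v = find (λ i → corner i == v)

  branch-corner : ∀ i → branch (corner i) ≡ just i
  branch-corner zero rewrite ==-refl x = refl
  branch-corner (suc zero)
    rewrite ≢⇒==false x≢y | ==-refl y = refl
  branch-corner (suc (suc zero))
    rewrite ≢⇒==false (λ x≡z → adjacent⇒≢ G zx (sym x≡z))
          | ≢⇒==false (λ y≡z → adjacent⇒≢ G zy (sym y≡z))
          | ==-refl z = refl

  branch⇒corner : ∀ v i → branch v ≡ just i → v ≡ corner i
  branch⇒corner v i e = sym (==⇒≡ (find-just (λ i → corner i == v) e))

  K₂,₁-model : Model (K2 1) G
  K₂,₁-model = record
    { br        = branch
    ; nonempty  = λ i → corner i , branch-corner i
    ; connected = λ i u v u∈ v∈ →
        ≡⇒path (trans (branch⇒corner u i u∈) (sym (branch⇒corner v i v∈)))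
    ; edges     = realise
    }
    where
    realise : ∀ i j → adj (K2 1) i j ≡ true →
      ∃₂ λ u v → branch u ≡ just i × branch v ≡ just j × adj G u v ≡ true
    realise zero (suc (suc zero)) _ = x , z , branch-corner _ , branch-corner _ , xz
    realise (suc zero) (suc (suc zero)) _ = y , z , branch-corner _ , branch-corner _ , yz
    realise (suc (suc zero)) zero _ = z , x , branch-corner _ , branch-corner _ , zx
    realise (suc (suc zero)) (suc zero) _ = z , y , branch-corner _ , branch-corner _ , zy

q+2≤m*q : ∀ m q → 2 ≤ m → 2 ≤ q → q + 2 ≤ m * q
q+2≤m*q m q m≥2 q≥2 = begin
  q + 2        ≤⟨ ℕ.+-monoʳ-≤ q q≥2 ⟩
  q + q        ≡⟨ cong (q +_) (ℕ.+-identityʳ q) ⟨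
  2 * q        ≤⟨ ℕ.*-monoˡ-≤ q m≥2 ⟩
  m * q        ∎
  where open ℕ.≤-Reasoning

fin-or-empty : ∀ k → (Fin k → ⊥) ⊎ Fin k
fin-or-empty zero    = inj₁ λ ()
fin-or-empty (suc k) = inj₂ zero

-- The interior of piece j is attached to the rest
-- of G only through the two vertices xG j, yG j of G that come from x1 j, y1 j.
module TwoSum (d : TwoSumData) (G : Graph) (iso : IsTwoSum G d) where
  open TwoSumData d
  open IsTwoSum iso

  V : Set
  V = Fin (n G)

  z-isZ : ∀ j → isZ d (z j) ≡ true
  z-isZ j = anyF-intro (λ k → z k == z j) j (==-refl (z j))

  z-injective : ∀ j k → z j ≡ z k → j ≡ k
  z-injective j k e with j ≟ k
  ... | yes j≡k = j≡k
  ... | no  j≢k = ⊥-elim (z-distinct j k j≢k e)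

  neighbour-of-z-kept : ∀ j a → adj G1 a (z j) ≡ true → T (not (isZ d a))
  neighbour-of-z-kept j a e with isZ d a in a-isZ
  ... | false = tt
  ... | true with k , zk==a ← anyF-witness (λ k → z k == a) a-isZ
             with refl ← ==⇒≡ {a = z k} {b = a} zk==a
             with () ← trans (sym (z-nonadj k j)) e

  not-kept⇒z : ∀ a → ¬ T (not (isZ d a)) → ∃ λ j → z j ≡ a
  not-kept⇒z a not-kept with isZ d a in a-isZ
  ... | false = ⊥-elim (not-kept tt)
  ... | true with j , hit ← anyF-witness _ a-isZ = j , ==⇒≡ hit

  x-kept : ∀ j → T (not (isZ d (x1 j)))
  x-kept j = neighbour-of-z-kept j (x1 j) (proj₁ (proj₂ (deg1 j)))

  y-kept : ∀ j → T (not (isZ d (y1 j)))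
  y-kept j = neighbour-of-z-kept j (y1 j) (proj₁ (proj₂ (proj₂ (deg1 j))))

  xG yG : Fin t → V
  xG j = from (inj₁ (x1 j , x-kept j))
  yG j = from (inj₁ (y1 j , y-kept j))

  to-xG : ∀ j → to (xG j) ≡ inj₁ (x1 j , x-kept j)
  to-xG j = to-from _

  to-yG : ∀ j → to (yG j) ≡ inj₁ (y1 j , y-kept j)
  to-yG j = to-from _

  position-G1 : ∀ {u a p b} (q : T (not (isZ d b))) → to u ≡ inj₁ (a , p) → a ≡ b →
                u ≡ from (inj₁ (b , q))
  position-G1 {u} {p = p} q e refl rewrite T-irrelevant p q = trans (sym (from-to u)) (cong from e)

  position-piece : ∀ {u j a p} (q : T (inner d j a)) → to u ≡ inj₂ (j , a , p) →
                   u ≡ from (inj₂ (j , a , q))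
  position-piece {u} {p = p} q e rewrite T-irrelevant p q = trans (sym (from-to u)) (cong from e)

  inPiece : Fin t → SumV d → Bool
  inPiece j (inj₁ _)           = false
  inPiece j (inj₂ (k , _ , _)) = k == j

  inPiece-inv : ∀ j s → inPiece j s ≡ true → ∃₂ λ u p → s ≡ inj₂ (j , u , p)
  inPiece-inv j (inj₂ (k , u , p)) e with refl ← ==⇒≡ {a = k} {b = j} e = u , p , refl

  inPiece-intro : ∀ {v j u p} → to v ≡ inj₂ (j , u , p) → inPiece j (to v) ≡ true
  inPiece-intro {j = j} e rewrite e = ==-refl j

  onG1 : SumV d → Bool
  onG1 (inj₁ _) = true
  onG1 (inj₂ _) = false

  inPiece⇒not-onG1 : ∀ j s → inPiece j s ≡ true → onG1 s ≡ false
  inPiece⇒not-onG1 j (inj₂ _) _ = refl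

  position : SumV d → Fin (n G1)
  position (inj₁ (a , _))     = a
  position (inj₂ (j , _ , _)) = z j

  adj12-cases : ∀ a j v′ → adj12 d a j v′ ≡ true →
    (a ≡ x1 j × adj (G2 j) (x2 j) v′ ≡ true) ⊎ (a ≡ y1 j × adj (G2 j) (y2 j) v′ ≡ true)
  adj12-cases a j v′ e with a == x1 j in ax | adj (G2 j) (x2 j) v′ in xv | a == y1 j in ay
  ... | true  | true  | _    = inj₁ (==⇒≡ ax , refl)
  ... | true  | false | true = inj₂ (==⇒≡ ay , e)
  ... | false | _     | true = inj₂ (==⇒≡ ay , e)

  adj22-cases : ∀ k j u′ v′ → adj22 d k j u′ v′ ≡ true →
    Σ (k ≡ j) λ { refl → adj (G2 k) u′ v′ ≡ true }
  adj22-cases k j u′ v′ e with k ≟ j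
  ... | yes refl = refl , e

  data Attachment (u : V) (j : Fin t) (v′ : Fin (n (G2 j))) : Set where
    via-inner : ∀ u′ p′ → to u ≡ inj₂ (j , u′ , p′) → adj (G2 j) u′ v′ ≡ true →
                Attachment u j v′
    via-x     : u ≡ xG j → adj (G2 j) (x2 j) v′ ≡ true → Attachment u j v′
    via-y     : u ≡ yG j → adj (G2 j) (y2 j) v′ ≡ true → Attachment u j v′

  attachment : ∀ u v j v′ p → adj G u v ≡ true → to v ≡ inj₂ (j , v′ , p) → Attachment u j v′
  attachment u v j v′ p e ev rewrite adj-to u v | ev with to u in eu
  ... | inj₁ (a , pa) with adj12-cases a j v′ e
  ...   | inj₁ (refl , xv) = via-x (position-G1 (x-kept j) eu refl) xv
  ...   | inj₂ (refl , yv) = via-y (position-G1 (y-kept j) eu refl) yv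
  attachment u v j v′ p e ev | inj₂ (k , u′ , pu) with adj22-cases k j u′ v′ e
  ... | refl , uv = via-inner u′ pu eu uv

  module Leaves (N : ℕ) (M : Model (K2 N) G) where
    open Model M

    -- A branch set that meets the interior of piece j but contains neither
    -- xG j nor yG j lies entirely in the interior of piece j: the interior is
    -- left only through xG j or yG j.
    trapped-path : ∀ i j {a b} → br (xG j) ≢ just i → br (yG j) ≢ just i →
      Path G (λ w → br w ≡ just i) a b → inPiece j (to a) ≡ true → inPiece j (to b) ≡ true
    trapped-path i j x∉ y∉ here a-in = a-in
    trapped-path i j x∉ y∉ (step {u = a} {v = c} e c∈ p) a-in
      with a′ , pa , ea ← inPiece-inv j (to a) a-in
      with attachment c a j a′ pa (trans (Graph.sym G c a) e) ea
    ... | via-inner _ _ ec _ = trapped-path i j x∉ y∉ p (inPiece-intro ec)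
    ... | via-x refl _ = ⊥-elim (x∉ c∈)
    ... | via-y refl _ = ⊥-elim (y∉ c∈)

    trapped : ∀ i j v₀ → br v₀ ≡ just i → inPiece j (to v₀) ≡ true →
      br (xG j) ≢ just i → br (yG j) ≢ just i → ∀ v → br v ≡ just i → inPiece j (to v) ≡ true
    trapped i j v₀ v₀∈ v₀-in x∉ y∉ v v∈ =
      trapped-path i j x∉ y∉ (connected i v₀ v v₀∈ v∈) v₀-in

    LeafInside : Fin t → Fin N → Set
    LeafInside j k = ∀ v → br v ≡ just (leaf k) → inPiece j (to v) ≡ true

    leaf-vertex : Fin N → V
    leaf-vertex k = proj₁ (nonempty (leaf k))

    leaf-vertex∈ : ∀ k → br (leaf-vertex k) ≡ just (leaf k)
    leaf-vertex∈ k = proj₂ (nonempty (leaf k))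

    xG-onG1 : ∀ j → onG1 (to (xG j)) ≡ true
    xG-onG1 j rewrite to-xG j = refl

    yG-onG1 : ∀ j → onG1 (to (yG j)) ≡ true
    yG-onG1 j rewrite to-yG j = refl

    G1-in-leaf : Fin N → V → Bool
    G1-in-leaf k v = (br v =M just (leaf k)) ∧ onG1 (to v)

    slot-from : Fin N → Maybe V → Fin (n G1)
    slot-from k (just v) = position (to v)
    slot-from k nothing  = position (to (leaf-vertex k))

    slot : Fin N → Fin (n G1)
    slot k = slot-from k (find (G1-in-leaf k))

    data SlotCase (k : Fin N) : Set where
      has-G1 : ∀ v a p → br v ≡ just (leaf k) → to v ≡ inj₁ (a , p) → slot k ≡ a → SlotCase k
      no-G1  : (∀ v → br v ≡ just (leaf k) → onG1 (to v) ≡ false) →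
               slot k ≡ position (to (leaf-vertex k)) → SlotCase k

    slot-case : ∀ k → SlotCase k
    slot-case k with find (G1-in-leaf k) in found
    ... | nothing = no-G1 none (cong (slot-from k) found)
      where
      none : ∀ v → br v ≡ just (leaf k) → onG1 (to v) ≡ false
      none v v∈ with find-nothing (G1-in-leaf k) found v
      ... | e rewrite v∈ | =M-refl (just (leaf k)) = e
    ... | just v with find-just (G1-in-leaf k) found
    ... | hit with to v in tv
    ...   | inj₁ (a , p) =
      has-G1 v a p (=M⇒≡ (∧-conicalˡ _ _ hit)) tv (trans (cong (slot-from k) found) (cong position tv))
    ...   | inj₂ _ with () ← ∧-conicalʳ (br v =M just (leaf k)) _ hit

    slot-on-G1 : ∀ k → isZ d (slot k) ≡ false →
      ∃₂ λ v p → br v ≡ just (leaf k) × to v ≡ inj₁ (slot k , p)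
    slot-on-G1 k slot-kept with slot-case k
    ... | has-G1 v a p v∈ tv refl = v , p , v∈ , tv
    ... | no-G1 none slot≡ with to (leaf-vertex k) in tv
    ...   | inj₁ _ with () ← trans (sym (none (leaf-vertex k) (leaf-vertex∈ k))) (cong onG1 tv)
    ...   | inj₂ (j , _ , _) with () ← trans (sym (trans (cong (isZ d) slot≡) (z-isZ j))) slot-kept

    slot-injective : ∀ k k′ → slot k ≡ slot k′ → isZ d (slot k) ≡ false → k ≡ k′
    slot-injective k k′ same kept
      with v , p , v∈ , tv ← slot-on-G1 k kept
      with v′ , p′ , v′∈ , tv′ ← slot-on-G1 k′ (subst (λ s → isZ d s ≡ false) same kept) =
      Fin.suc-injective (Fin.suc-injective (just-injective
        (trans (sym v∈) (trans (cong br v≡v′) v′∈))))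
      where
      v≡v′ : v ≡ v′
      v≡v′ = trans (position-G1 p tv refl) (sym (position-G1 p tv′ (sym same)))

    slot-z⇒inside : ∀ k j → slot k ≡ z j → LeafInside j k
    slot-z⇒inside k j slot≡z with slot-case k
    ... | has-G1 v a p _ _ slot≡a =
      ⊥-elim (subst (λ b → T (not b)) (trans (cong (isZ d) (trans (sym slot≡a) slot≡z)) (z-isZ j)) p)
    ... | no-G1 none slot≡ with to (leaf-vertex k) in tv
    ...   | inj₁ _ with () ← trans (sym (none (leaf-vertex k) (leaf-vertex∈ k))) (cong onG1 tv)
    ...   | inj₂ (j′ , _ , _) with refl ← z-injective j′ j (trans (sym slot≡) slot≡z) =
      trapped (leaf k) j (leaf-vertex k) (leaf-vertex∈ k) (inPiece-intro tv)
        (λ x∈ → G1-not-in (xG j) x∈ (xG-onG1 j)) (λ y∈ → G1-not-in (yG j) y∈ (yG-onG1 j))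
      where
      G1-not-in : ∀ v → br v ≡ just (leaf k) → onG1 (to v) ≢ true
      G1-not-in v v∈ e with () ← trans (sym (none v v∈)) e

    trapped⇒slot-z : ∀ k j v₀ → br v₀ ≡ just (leaf k) → inPiece j (to v₀) ≡ true →
      br (xG j) ≢ just (leaf k) → br (yG j) ≢ just (leaf k) → slot k ≡ z j
    trapped⇒slot-z k j v₀ v₀∈ v₀-in x∉ y∉ with slot-case k
    ... | has-G1 v _ _ v∈ tv _
      with () ← trans (sym (inPiece⇒not-onG1 j _ (trapped (leaf k) j v₀ v₀∈ v₀-in x∉ y∉ v v∈)))
                      (cong onG1 tv)
    ... | no-G1 _ slot≡
      with _ , _ , tv ← inPiece-inv j (to (leaf-vertex k))
                          (trapped (leaf k) j v₀ v₀∈ v₀-in x∉ y∉ (leaf-vertex k) (leaf-vertex∈ k)) =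
      trans slot≡ (cong position tv)

    PoleTrapped : Fin (2 + N) → Fin t → Set
    PoleTrapped P j = ∃ λ v → br v ≡ just P × inPiece j (to v) ≡ true ×
                      br (xG j) ≢ just P × br (yG j) ≢ just P

    PoleFree : Fin (2 + N) → Set
    PoleFree P = ∀ j v → br v ≡ just P → inPiece j (to v) ≡ true →
                 br (xG j) ≡ just P ⊎ br (yG j) ≡ just P

    trapped-test : Fin (2 + N) → Fin t → V → Bool
    trapped-test P j v = (br v =M just P) ∧ inPiece j (to v) ∧
                         not (br (xG j) =M just P) ∧ not (br (yG j) =M just P)

    pole-trapped? : ∀ P → PoleFree P ⊎ ∃ (PoleTrapped P)
    pole-trapped? P with anyF (λ j → anyF (trapped-test P j)) in found
    ... | true with j , hit-j ← anyF-witness _ found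
               with v , hit ← anyF-witness _ hit-j
               with br v =M just P in v∈ | inPiece j (to v) in v-in
                  | br (xG j) =M just P in x∈ | br (yG j) =M just P in y∈
    ... | true | true | false | false =
      inj₂ (j , v , =M⇒≡ v∈ , v-in , =Mfalse⇒≢ x∈ , =Mfalse⇒≢ y∈)
    pole-trapped? P | false = inj₁ free
      where
      free : PoleFree P
      free j v v∈ v-in with anyF-false _ (anyF-false _ found j) v
      ... | miss rewrite v∈ | =M-refl (just P) | v-in
                 with br (xG j) =M just P in x∈ | br (yG j) =M just P in y∈
      ...   | true  | _    = inj₁ (=M⇒≡ x∈)
      ...   | false | true = inj₂ (=M⇒≡ y∈)

    free-pole-meets-xy : ∀ P k j → PoleFree P → adj (K2 N) P (leaf k) ≡ true → LeafInside j k →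
                         br (xG j) ≡ just P ⊎ br (yG j) ≡ just P
    free-pole-meets-xy P k j free Pk inside
      with u , v , u∈ , v∈ , uv ← edges P (leaf k) Pk
      with v′ , pv , tv ← inPiece-inv j (to v) (inside v v∈)
      with attachment u v j v′ pv uv tv
    ... | via-inner _ _ tu _ = free j u u∈ (inPiece-intro tu)
    ... | via-x refl _ = inj₁ u∈
    ... | via-y refl _ = inj₂ u∈

    in-leaf : ∀ {v k} → br v ≡ just (leaf k) → (br v =M just (leaf k)) ≡ true
    in-leaf {k = k} v∈ rewrite v∈ = =M-refl (just (leaf k))

    trapped-pole-covers : ∀ P j → (∀ k → adj (K2 N) P (leaf k) ≡ true) → PoleTrapped P j →
      ∀ k → ((slot k == z j) ∨ ((br (xG j) =M just (leaf k)) ∨ (br (yG j) =M just (leaf k)))) ≡ true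
    trapped-pole-covers P j Pk (v₀ , v₀∈ , v₀-in , x∉ , y∉) k
      with u , v , u∈ , v∈ , uv ← edges P (leaf k) (Pk k)
      with u′ , pu , tu ← inPiece-inv j (to u) (trapped P j v₀ v₀∈ v₀-in x∉ y∉ u u∈)
      with attachment v u j u′ pu (trans (Graph.sym G v u) uv) tu
         | br (xG j) =M just (leaf k) in x∈ | br (yG j) =M just (leaf k) in y∈
    ... | _ | true | _ = ∨-zeroʳ (slot k == z j)
    ... | _ | false | true = ∨-zeroʳ (slot k == z j)
    ... | via-x refl _ | false | false with () ← trans (sym x∈) (in-leaf v∈)
    ... | via-y refl _ | false | false with () ← trans (sym y∈) (in-leaf v∈)
    ... | via-inner _ _ tv _ | false | false
      rewrite trapped⇒slot-z k j v v∈ (inPiece-intro tv) (=Mfalse⇒≢ x∈) (=Mfalse⇒≢ y∈) =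
        cong (_∨ false) (==-refl (z j))

    leaves-at-vertex≤1 : ∀ v → count (λ k → br v =M just (leaf k)) ≤ 1
    leaves-at-vertex≤1 v = count-unique _ λ a b a∈ b∈ →
      Fin.suc-injective (Fin.suc-injective (just-injective
        (trans (sym (=M⇒≡ {a = br v} a∈)) (=M⇒≡ {a = br v} b∈))))

    trapped-pole-count : ∀ P j → (∀ k → adj (K2 N) P (leaf k) ≡ true) → PoleTrapped P j →
                         N ≤ count (λ k → slot k == z j) + 2
    trapped-pole-count P j Pk trap = begin
      N
        ≡⟨ count-all N ⟨
      count {N} (λ _ → true)
        ≤⟨ count-mono _ _ (λ k _ → trapped-pole-covers P j Pk trap k) ⟩
      count (λ k → (slot k == z j) ∨ (atX k ∨ atY k))
        ≤⟨ count-∨ (λ k → slot k == z j) _ ⟩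
      count (λ k → slot k == z j) + count (λ k → atX k ∨ atY k)
        ≤⟨ ℕ.+-monoʳ-≤ _ (ℕ.≤-trans (count-∨ atX atY)
             (ℕ.+-mono-≤ (leaves-at-vertex≤1 (xG j)) (leaves-at-vertex≤1 (yG j)))) ⟩
      count (λ k → slot k == z j) + 2
        ∎
      where
      open ℕ.≤-Reasoning
      atX atY : Fin N → Bool
      atX k = br (xG j) =M just (leaf k)
      atY k = br (yG j) =M just (leaf k)

    -- Send inner vertices of piece j to themselves, xG j and yG j to x2 j and
    -- y2 j, and every other vertex v to x2 j, y2 j or w j according as v lies
    -- in the branch set of xG j, of yG j (w j if these coincide), or neither.
    module IntoPiece (j : Fin t) (q : ℕ) (e : Fin q → Fin N) (e-inj : ∀ a b → e a ≡ e b → a ≡ b)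
                     (inside : ∀ r → LeafInside j (e r)) (r₀ : Fin q) where
      open LeafEmbedding e e-inj

      H : Graph
      H = G2 j

      private
        x≢y : x2 j ≢ y2 j
        x≢y = proj₁ (deg2 j)
        xw : adj H (x2 j) (w j) ≡ true
        xw = proj₁ (proj₂ (deg2 j))
        yw : adj H (y2 j) (w j) ≡ true
        yw = proj₁ (proj₂ (proj₂ (deg2 j)))
        wx : adj H (w j) (x2 j) ≡ true
        wx = trans (Graph.sym H (w j) (x2 j)) xw
        wy : adj H (w j) (y2 j) ≡ true
        wy = trans (Graph.sym H (w j) (y2 j)) yw

      βx βy : Maybe (Fin (2 + N))
      βx = br (xG j)
      βy = br (yG j)

      xy-same : Bool
      xy-same = βx =M βy

      collapse : V → Fin (n H)
      collapse v = if br v =M βx then (if xy-same then w j else x2 j)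
                   else (if br v =M βy then y2 j else w j)

      collapse-cherry : ∀ v → OneOf (x2 j) (y2 j) (w j) (collapse v)
      collapse-cherry v with br v =M βx | xy-same | br v =M βy
      ... | true  | true  | _     = inj₂ (inj₂ refl)
      ... | true  | false | _     = inj₁ refl
      ... | false | _     | true  = inj₂ (inj₁ refl)
      ... | false | _     | false = inj₂ (inj₂ refl)

      image-of : V → SumV d → Fin (n H)
      image-of v (inj₁ (a , _)) = if a == x1 j then x2 j else (if a == y1 j then y2 j else collapse v)
      image-of v (inj₂ (k , u , _)) with k ≟ j
      ... | yes refl = u
      ... | no _     = collapse v

      image : V → Fin (n H)
      image v = image-of v (to v)

      image-of-x : ∀ v {a} p → a ≡ x1 j → image-of v (inj₁ (a , p)) ≡ x2 j
      image-of-x v p refl rewrite ==-refl (x1 j) = refl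

      image-of-y : ∀ v {a} p → (a == x1 j) ≡ false → a ≡ y1 j → image-of v (inj₁ (a , p)) ≡ y2 j
      image-of-y v p a≢x refl rewrite a≢x | ==-refl (y1 j) = refl

      image-of-out : ∀ v {a} p → (a == x1 j) ≡ false → (a == y1 j) ≡ false →
                     image-of v (inj₁ (a , p)) ≡ collapse v
      image-of-out v p a≢x a≢y rewrite a≢x | a≢y = refl

      image-of-inner : ∀ v u p → image-of v (inj₂ (j , u , p)) ≡ u
      image-of-inner v u p with j ≟ j
      ... | yes refl = refl
      ... | no  j≢j  = ⊥-elim (j≢j refl)

      image-of-other : ∀ v {k} u p → k ≢ j → image-of v (inj₂ (k , u , p)) ≡ collapse v
      image-of-other v {k} u p k≢j with k ≟ j
      ... | yes k≡j = ⊥-elim (k≢j k≡j)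
      ... | no  _   = refl

      image-inner : ∀ v u p → to v ≡ inj₂ (j , u , p) → image v ≡ u
      image-inner v u p tv = trans (cong (image-of v) tv) (image-of-inner v u p)

      image-x : image (xG j) ≡ x2 j
      image-x = trans (cong (image-of _) (to-xG j)) (image-of-x _ (x-kept j) refl)

      image-y : image (yG j) ≡ y2 j
      image-y = trans (cong (image-of _) (to-yG j))
                      (image-of-y _ (y-kept j) (≢⇒==false (λ y≡x → proj₁ (deg1 j) (sym y≡x))) refl)

      data ImageCase (v : V) : Set where
        img-inner : ∀ u p → to v ≡ inj₂ (j , u , p) → ImageCase v
        img-x     : v ≡ xG j → ImageCase v
        img-y     : v ≡ yG j → ImageCase v
        img-out   : inPiece j (to v) ≡ false → image v ≡ collapse v → ImageCase v

      image-case : ∀ v → ImageCase v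
      image-case v with to v in tv
      ... | inj₁ (a , pa) with a == x1 j in ax | a == y1 j in ay
      ...   | true  | _     = img-x (position-G1 (x-kept j) tv (==⇒≡ ax))
      ...   | false | true  = img-y (position-G1 (y-kept j) tv (==⇒≡ ay))
      ...   | false | false = img-out (cong (inPiece j) tv) (trans (cong (image-of v) tv) (image-of-out v pa ax ay))
      image-case v | inj₂ (k , u , p) with k ≟ j
      ... | yes refl = img-inner u p tv
      ... | no  k≢j  = img-out (trans (cong (inPiece j) tv) (≢⇒==false k≢j))
                               (trans (cong (image-of v) tv) (image-of-other v u p k≢j))

      outside-cherry : ∀ v → inPiece j (to v) ≡ false → OneOf (x2 j) (y2 j) (w j) (image v)
      outside-cherry v out with image-case v
      ... | img-inner _ _ tv with () ← trans (sym out) (inPiece-intro tv)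
      ... | img-x refl = inj₁ image-x
      ... | img-y refl = inj₂ (inj₁ image-y)
      ... | img-out _ im rewrite im = collapse-cherry v

      boundary-branch : Fin (n H) → Maybe (Fin (2 + q))
      boundary-branch u = if u == x2 j then restrict βx
                          else if u == y2 j then restrict βy
                          else (if xy-same then restrict βx else nothing)

      branch : Fin (n H) → Maybe (Fin (2 + q))
      branch u with T? (inner d j u)
      ... | yes p = restrict (br (from (inj₂ (j , u , p))))
      ... | no  _ = boundary-branch u

      branch-inner : ∀ u p → branch u ≡ restrict (br (from (inj₂ (j , u , p))))
      branch-inner u p with T? (inner d j u)
      ... | yes p′ rewrite T-irrelevant p′ p = refl
      ... | no ¬p = ⊥-elim (¬p p)

      branch-boundary : ∀ u → ¬ T (inner d j u) → branch u ≡ boundary-branch u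
      branch-boundary u not-inner with T? (inner d j u)
      ... | yes p = ⊥-elim (not-inner p)
      ... | no  _ = refl

      inner-w : ¬ T (inner d j (w j))
      inner-w rewrite ==-refl (w j) = λ ()

      inner-x : ¬ T (inner d j (x2 j))
      inner-x rewrite ≢⇒==false (adjacent⇒≢ H xw) | ==-refl (x2 j) = λ ()

      inner-y : ¬ T (inner d j (y2 j))
      inner-y rewrite ≢⇒==false (adjacent⇒≢ H yw) | ≢⇒==false (λ y≡x → x≢y (sym y≡x))
                    | ==-refl (y2 j) = λ ()

      branch-x : branch (x2 j) ≡ restrict βx
      branch-x rewrite branch-boundary (x2 j) inner-x | ==-refl (x2 j) = refl

      branch-y : branch (y2 j) ≡ restrict βy
      branch-y rewrite branch-boundary (y2 j) inner-y | ≢⇒==false (λ y≡x → x≢y (sym y≡x))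
                     | ==-refl (y2 j) = refl

      branch-w : branch (w j) ≡ (if xy-same then restrict βx else nothing)
      branch-w rewrite branch-boundary (w j) inner-w
                     | ≢⇒==false (λ w≡x → adjacent⇒≢ H xw (sym w≡x))
                     | ≢⇒==false (λ w≡y → adjacent⇒≢ H yw (sym w≡y)) = refl

      collapse-branch : ∀ v → br v ≡ βx ⊎ br v ≡ βy → branch (collapse v) ≡ restrict (br v)
      collapse-branch v at with br v =M βx in vx | xy-same in same
      ... | true | true  = trans branch-w (trans (cong (λ b → if b then restrict βx else nothing) same)
                                                 (cong restrict (sym (=M⇒≡ {a = br v} vx))))
      ... | true | false = trans branch-x (cong restrict (sym (=M⇒≡ {a = br v} vx)))
      collapse-branch v (inj₁ v≡x) | false | _ = ⊥-elim (=Mfalse⇒≢ vx v≡x)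
      collapse-branch v (inj₂ v≡y) | false | _ rewrite v≡y | =M-refl βy = branch-y

      -- A vertex outside piece j in a kept branch set lies in the branch set of
      -- xG j or yG j: leaves e r are inside, and a pole reaching the interior
      -- (it is adjacent to the inside leaf e r₀) but avoiding xG j, yG j would
      -- be trapped there.
      pole-outside : ∀ P → adj (K2 N) P (leaf (e r₀)) ≡ true → ∀ v → br v ≡ just P →
                     inPiece j (to v) ≡ false → br v ≡ βx ⊎ br v ≡ βy
      pole-outside P P-leaf v v∈ out
        with u , v′ , u∈ , v′∈ , uv′ ← edges P (leaf (e r₀)) P-leaf
        with v″ , pv , tv′ ← inPiece-inv j (to v′) (inside r₀ v′ v′∈)
        with attachment u v′ j v″ pv uv′ tv′
      ... | via-x refl _ = inj₁ (trans v∈ (sym u∈))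
      ... | via-y refl _ = inj₂ (trans v∈ (sym u∈))
      ... | via-inner _ _ tu _ with Maybe.≡-dec _≟_ βx (just P) | Maybe.≡-dec _≟_ βy (just P)
      ...   | yes x∈ | _      = inj₁ (trans v∈ (sym x∈))
      ...   | no _   | yes y∈ = inj₂ (trans v∈ (sym y∈))
      ...   | no x∉  | no y∉
        with () ← trans (sym out) (trapped P j u u∈ (inPiece-intro tu) x∉ y∉ v v∈)

      kept-outside : ∀ v i → br v ≡ just (embed i) → inPiece j (to v) ≡ false →
                     br v ≡ βx ⊎ br v ≡ βy
      kept-outside v zero          v∈ out = pole-outside zero refl v v∈ out
      kept-outside v (suc zero)    v∈ out = pole-outside (suc zero) refl v v∈ out
      kept-outside v (suc (suc r)) v∈ out with () ← trans (sym out) (inside r v v∈)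

      image-in-branch : ∀ v i → br v ≡ just (embed i) → branch (image v) ≡ just i
      image-in-branch v i v∈ = trans (branch-image (image-case v)) (trans (cong restrict v∈) (restrict-embed i))
        where
        branch-image : ImageCase v → branch (image v) ≡ restrict (br v)
        branch-image (img-inner u p tv) =
          trans (cong branch (image-inner v u p tv))
                (trans (branch-inner u p) (cong (restrict ∘ br) (sym (position-piece p tv))))
        branch-image (img-x refl) = trans (cong branch image-x) branch-x
        branch-image (img-y refl) = trans (cong branch image-y) branch-y
        branch-image (img-out out im) = trans (cong branch im) (collapse-branch v (kept-outside v i v∈ out))

      edge-into-piece : ∀ u v → adj G u v ≡ true → inPiece j (to v) ≡ true →
                        adj H (image u) (image v) ≡ true
      edge-into-piece u v uv v-in with v′ , pv , tv ← inPiece-inv j (to v) v-in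
        rewrite image-inner v v′ pv tv with attachment u v j v′ pv uv tv
      ... | via-inner u′ pu tu u′v′ rewrite image-inner u u′ pu tu = u′v′
      ... | via-x refl xv′ rewrite image-x = xv′
      ... | via-y refl yv′ rewrite image-y = yv′

      edge-out-of-piece : ∀ u v → adj G u v ≡ true → inPiece j (to u) ≡ true →
                          adj H (image u) (image v) ≡ true
      edge-out-of-piece u v uv u-in =
        trans (Graph.sym H (image u) (image v)) (edge-into-piece v u (trans (Graph.sym G v u) uv) u-in)

      InBranch : Fin (2 + q) → Fin (n H) → Set
      InBranch i a = branch a ≡ just i

      centre-in-branch : ∀ i → InBranch i (x2 j) → InBranch i (y2 j) → InBranch i (w j)
      centre-in-branch i x∈ y∈ =
        trans branch-w (trans (cong (λ b → if b then restrict βx else nothing) same) (trans (sym branch-x) x∈))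
        where
        same : xy-same ≡ true
        same rewrite restrict⇒embed βx i (trans (sym branch-x) x∈)
                   | restrict⇒embed βy i (trans (sym branch-y) y∈) = =M-refl (just (embed i))

      inner-edge : ∀ u v i → br u ≡ just (embed i) → br v ≡ just (embed i) → adj G u v ≡ true →
                   Path H (InBranch i) (image u) (image v)
      inner-edge u v i u∈ v∈ uv with inPiece j (to v) in v-in | inPiece j (to u) in u-in
      ... | true  | _    = edge-path (edge-into-piece u v uv v-in) (image-in-branch v i v∈)
      ... | false | true = edge-path (edge-out-of-piece u v uv u-in) (image-in-branch v i v∈)
      ... | false | false =
        cherry-path (x2 j) (y2 j) (w j) wx wy (centre-in-branch i) (image u) (image v)
          (outside-cherry u u-in) (outside-cherry v v-in) (image-in-branch u i u∈) (image-in-branch v i v∈)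

      data BoundaryCase (a : Fin (n H)) : Set where
        at-x : a ≡ x2 j → BoundaryCase a
        at-y : a ≡ y2 j → BoundaryCase a
        at-w : a ≡ w j  → BoundaryCase a

      boundary-case : ∀ a → ¬ T (inner d j a) → BoundaryCase a
      boundary-case a not-inner with a == x2 j in ax | a == y2 j in ay | a == w j in aw
      ... | true  | _     | _     = at-x (==⇒≡ ax)
      ... | false | true  | _     = at-y (==⇒≡ ay)
      ... | false | false | true  = at-w (==⇒≡ aw)
      ... | false | false | false = ⊥-elim (not-inner tt)

      w-branch : ∀ {i} → (if xy-same then restrict βx else nothing) ≡ just i → restrict βx ≡ just i
      w-branch b with xy-same
      ... | true = b

      branch-reached : ∀ v′ i → branch v′ ≡ just i →
                       ∃ λ v → br v ≡ just (embed i) × Path H (InBranch i) (image v) v′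
      branch-reached v′ i v′∈ = reach (T? (inner d j v′))
        where
        Reached : Fin (n H) → Set
        Reached a = ∃ λ v → br v ≡ just (embed i) × Path H (InBranch i) (image v) a
        reach-boundary : ∀ a → BoundaryCase a → branch a ≡ just i → Reached a
        reach-boundary _ (at-x refl) a∈ =
          xG j , restrict⇒embed βx i (trans (sym branch-x) a∈) , ≡⇒path image-x
        reach-boundary _ (at-y refl) a∈ =
          yG j , restrict⇒embed βy i (trans (sym branch-y) a∈) , ≡⇒path image-y
        reach-boundary _ (at-w refl) a∈ =
          xG j , restrict⇒embed βx i (w-branch (trans (sym branch-w) a∈)) ,
          ≡⇒path image-x ++ᴾ edge-path xw a∈
        reach : Dec (T (inner d j v′)) → Reached v′
        reach (yes p) = from (inj₂ (j , v′ , p)) ,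
                        restrict⇒embed _ i (trans (sym (branch-inner v′ p)) v′∈) ,
                        ≡⇒path (image-inner _ v′ p (to-from _))
        reach (no not-inner) = reach-boundary v′ (boundary-case v′ not-inner) v′∈

      -- every edge of K_{2,q} has a leaf end, inside piece j, so the edge survives
      cross-edge : ∀ u v i i′ → br u ≡ just (embed i) → br v ≡ just (embed i′) → adj G u v ≡ true →
        adj (K2 q) i i′ ≡ true →
        ∃₂ λ u′ v′ → branch u′ ≡ just i × branch v′ ≡ just i′ × adj H u′ v′ ≡ true
      cross-edge u v i i′ u∈ v∈ uv ii′ =
        image u , image v , image-in-branch u i u∈ , image-in-branch v i′ v∈ , image-edge i i′ u∈ v∈ ii′
        where
        image-edge : ∀ i i′ → br u ≡ just (embed i) → br v ≡ just (embed i′) → adj (K2 q) i i′ ≡ true →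
                     adj H (image u) (image v) ≡ true
        image-edge (suc (suc r)) _ u∈ _ _ = edge-out-of-piece u v uv (inside r u u∈)
        image-edge zero (suc (suc r)) _ v∈ _ = edge-into-piece u v uv (inside r v v∈)
        image-edge (suc zero) (suc (suc r)) _ v∈ _ = edge-into-piece u v uv (inside r v v∈)

      piece-model : Model (K2 q) (G2 j)
      piece-model = projected-model M embed embed-adj record
        { image = image ; branch′ = branch ; image-in-branch = image-in-branch
        ; branch-reached = branch-reached ; inner-edge = inner-edge ; cross-edge = cross-edge }

    -- Send vertices of G1 to themselves
    -- and an inner vertex v of piece j to x1 j, y1 j or z j according as v
    -- lies in the branch set of xG j, of yG j, or neither.  The vertex z j joins
    -- the branch set of xG j if that equals the one of yG j; otherwise it joins
    -- the chosen leaf with slot z j if there is one, and xG j's branch set if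
    -- not.
    module IntoG1 (m : ℕ) (h : Fin m → Fin N) (slots-distinct : ∀ a b → slot (h a) ≡ slot (h b) → a ≡ b)
                  (free₀ : PoleFree zero) (free₁ : PoleFree (suc zero)) where
      open LeafEmbedding h (λ a b e → slots-distinct a b (cong slot e))

      βx βy : Fin t → Maybe (Fin (2 + N))
      βx j = br (xG j)
      βy j = br (yG j)

      xy-same : Fin t → Bool
      xy-same j = βx j =M βy j

      representative : Fin t → Maybe (Fin m)
      representative j = find (λ r → slot (h r) == z j)

      representative-slot : ∀ j {r} → representative j ≡ just r → slot (h r) ≡ z j
      representative-slot j found = ==⇒≡ (find-just (λ r → slot (h r) == z j) found)

      representative-unique : ∀ j r → slot (h r) ≡ z j → representative j ≡ just r
      representative-unique j r slot≡ with representative j in found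
      ... | just r′ = cong just (slots-distinct r′ r (trans (representative-slot j found) (sym slot≡)))
      ... | nothing
        with () ← trans (sym (find-nothing _ found r)) (trans (cong (_== z j) slot≡) (==-refl (z j)))

      z-branch-from : Fin t → Bool → Maybe (Fin m) → Maybe (Fin (2 + m))
      z-branch-from j true  _        = restrict (βx j)
      z-branch-from j false (just r) = just (leaf r)
      z-branch-from j false nothing  = restrict (βx j)

      z-branch : Fin t → Maybe (Fin (2 + m))
      z-branch j = z-branch-from j (xy-same j) (representative j)

      branch-from : ∀ a → Dec (T (not (isZ d a))) → Maybe (Fin (2 + m))
      branch-from a (yes kept) = restrict (br (from (inj₁ (a , kept))))
      branch-from a (no not-kept) = z-branch (proj₁ (not-kept⇒z a not-kept))

      branch : Fin (n G1) → Maybe (Fin (2 + m))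
      branch a = branch-from a (T? (not (isZ d a)))

      InBranch : Fin (2 + m) → Fin (n G1) → Set
      InBranch i a = branch a ≡ just i

      branch-kept : ∀ a p → branch a ≡ restrict (br (from (inj₁ (a , p))))
      branch-kept a p with T? (not (isZ d a))
      ... | yes p′ rewrite T-irrelevant p′ p = refl
      ... | no ¬p = ⊥-elim (¬p p)

      branch-z : ∀ j → branch (z j) ≡ z-branch j
      branch-z j with T? (not (isZ d (z j)))
      ... | yes p = ⊥-elim (subst (λ b → T (not b)) (z-isZ j) p)
      ... | no not-kept = cong z-branch (z-injective _ j (proj₂ (not-kept⇒z (z j) not-kept)))

      branch-x : ∀ j → branch (x1 j) ≡ restrict (βx j)
      branch-x j = branch-kept (x1 j) (x-kept j)

      branch-y : ∀ j → branch (y1 j) ≡ restrict (βy j)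
      branch-y j = branch-kept (y1 j) (y-kept j)

      -- both free poles meet {xG j, yG j} when some leaf lies inside piece j,
      -- so xG j and yG j then lie in different branch sets
      poles-at-xy : ∀ j k → LeafInside j k →
        (βx j ≡ just zero ⊎ βy j ≡ just zero) × (βx j ≡ just (suc zero) ⊎ βy j ≡ just (suc zero))
      poles-at-xy j k inside =
        free-pole-meets-xy zero k j free₀ refl inside , free-pole-meets-xy (suc zero) k j free₁ refl inside

      poles-distinct : just {A = Fin (2 + N)} zero ≢ just (suc zero)
      poles-distinct ()

      xy-differ : ∀ j k → LeafInside j k → βx j ≢ βy j
      xy-differ j k inside x≡y with poles-at-xy j k inside
      ... | inj₁ x₀ , inj₁ x₁ = poles-distinct (trans (sym x₀) x₁)
      ... | inj₁ x₀ , inj₂ y₁ = poles-distinct (trans (sym x₀) (trans x≡y y₁))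
      ... | inj₂ y₀ , inj₁ x₁ = poles-distinct (trans (sym y₀) (trans (sym x≡y) x₁))
      ... | inj₂ y₀ , inj₂ y₁ = poles-distinct (trans (sym y₀) y₁)

      z-branch-leaf : ∀ j r → slot (h r) ≡ z j → z-branch j ≡ just (leaf r)
      z-branch-leaf j r slot≡
        rewrite ≢⇒=Mfalse (xy-differ j (h r) (slot-z⇒inside (h r) j slot≡))
              | representative-unique j r slot≡ = refl

      -- an inner vertex of piece j outside the branch sets of xG j, yG j lies
      -- in a leaf trapped in piece j, whose slot is z j
      z-branch-trapped : ∀ j v i → br v ≡ just (embed i) → inPiece j (to v) ≡ true →
                         br v ≢ βx j → br v ≢ βy j → z-branch j ≡ just i
      z-branch-trapped j v zero v∈ v-in x∉ y∉ with free₀ j v v∈ v-in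
      ... | inj₁ x∈ = ⊥-elim (x∉ (trans v∈ (sym x∈)))
      ... | inj₂ y∈ = ⊥-elim (y∉ (trans v∈ (sym y∈)))
      z-branch-trapped j v (suc zero) v∈ v-in x∉ y∉ with free₁ j v v∈ v-in
      ... | inj₁ x∈ = ⊥-elim (x∉ (trans v∈ (sym x∈)))
      ... | inj₂ y∈ = ⊥-elim (y∉ (trans v∈ (sym y∈)))
      z-branch-trapped j v (suc (suc r)) v∈ v-in x∉ y∉ =
        z-branch-leaf j r (trapped⇒slot-z (h r) j v v∈ v-in (λ x∈ → x∉ (trans v∈ (sym x∈)))
                                                            (λ y∈ → y∉ (trans v∈ (sym y∈))))

      collapse : Fin t → Maybe (Fin (2 + N)) → Fin (n G1)
      collapse j b = if b =M βx j then x1 j else (if b =M βy j then y1 j else z j)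

      collapse-cherry : ∀ j b → OneOf (x1 j) (y1 j) (z j) (collapse j b)
      collapse-cherry j b with b =M βx j | b =M βy j
      ... | true  | _     = inj₁ refl
      ... | false | true  = inj₂ (inj₁ refl)
      ... | false | false = inj₂ (inj₂ refl)

      image-of : V → SumV d → Fin (n G1)
      image-of v (inj₁ (a , _))     = a
      image-of v (inj₂ (j , _ , _)) = collapse j (br v)

      image : V → Fin (n G1)
      image v = image-of v (to v)

      image-xG : ∀ j → image (xG j) ≡ x1 j
      image-xG j = cong (image-of (xG j)) (to-xG j)

      image-inside : ∀ j k v → LeafInside j k → br v ≡ just (leaf k) → image v ≡ z j
      image-inside j k v inside v∈ with u , p , tv ← inPiece-inv j (to v) (inside v v∈) =
        trans (cong (image-of v) tv) (collapse-z (avoid (xG j) (xG-onG1 j)) (avoid (yG j) (yG-onG1 j)))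
        where
        avoid : ∀ a → onG1 (to a) ≡ true → br v ≢ br a
        avoid a a-G1 v≡a with () ← trans (sym (inPiece⇒not-onG1 j _ (inside a (trans (sym v≡a) v∈)))) a-G1
        collapse-z : br v ≢ βx j → br v ≢ βy j → collapse j (br v) ≡ z j
        collapse-z x∉ y∉ rewrite ≢⇒=Mfalse x∉ | ≢⇒=Mfalse y∉ = refl

      image-in-branch : ∀ v i → br v ≡ just (embed i) → branch (image v) ≡ just i
      image-in-branch v i v∈ with to v in tv
      ... | inj₁ (a , p) =
        trans (branch-kept a p) (trans (cong (restrict ∘ br) (sym (position-G1 p tv refl)))
                                       (trans (cong restrict v∈) (restrict-embed i)))
      ... | inj₂ (j , u , p) with br v =M βx j in vx
      ...   | true =
        trans (branch-x j) (trans (cong restrict (trans (sym (=M⇒≡ {a = br v} vx)) v∈)) (restrict-embed i))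
      ...   | false with br v =M βy j in vy
      ...     | true =
        trans (branch-y j) (trans (cong restrict (trans (sym (=M⇒≡ {a = br v} vy)) v∈)) (restrict-embed i))
      ...     | false =
        trans (branch-z j) (z-branch-trapped j v i v∈ (inPiece-intro tv) (=Mfalse⇒≢ vx) (=Mfalse⇒≢ vy))

      private
        xz : ∀ j → adj G1 (x1 j) (z j) ≡ true
        xz j = proj₁ (proj₂ (deg1 j))
        yz : ∀ j → adj G1 (y1 j) (z j) ≡ true
        yz j = proj₁ (proj₂ (proj₂ (deg1 j)))
        zx : ∀ j → adj G1 (z j) (x1 j) ≡ true
        zx j = trans (Graph.sym G1 (z j) (x1 j)) (xz j)
        zy : ∀ j → adj G1 (z j) (y1 j) ≡ true
        zy j = trans (Graph.sym G1 (z j) (y1 j)) (yz j)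

      Cherry : Fin t → Fin (n G1) → Set
      Cherry j = OneOf (x1 j) (y1 j) (z j)

      -- Every edge of G is sent to an edge of G1 or into one cherry
      -- x1 j – z j – y1 j (edges inside a piece, and the virtual edge x1 j y1 j).
      data G1Edge (a b : Fin (n G1)) : Set where
        direct : adj G1 a b ≡ true → G1Edge a b
        cherry : ∀ j → Cherry j a → Cherry j b → G1Edge a b

      virtual-edge : ∀ j a b → (((a == x1 j) ∧ (b == y1 j)) ∨ ((a == y1 j) ∧ (b == x1 j))) ≡ true →
                     G1Edge a b
      virtual-edge j a b e with a == x1 j in ax | b == y1 j in by
      ... | true | true = cherry j (inj₁ (==⇒≡ ax)) (inj₂ (inj₁ (==⇒≡ by)))
      ... | true | false with a == y1 j in ay | b == x1 j in bx
      ...   | true | true = cherry j (inj₂ (inj₁ (==⇒≡ ay))) (inj₁ (==⇒≡ bx))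
      virtual-edge j a b e | false | _ with a == y1 j in ay | b == x1 j in bx
      ...   | true | true = cherry j (inj₂ (inj₁ (==⇒≡ ay))) (inj₁ (==⇒≡ bx))

      attachment-cherry : ∀ a j b → a ≡ x1 j ⊎ a ≡ y1 j → Cherry j a × Cherry j (collapse j b)
      attachment-cherry a j b (inj₁ a≡x) = inj₁ a≡x , collapse-cherry j b
      attachment-cherry a j b (inj₂ a≡y) = inj₂ (inj₁ a≡y) , collapse-cherry j b

      classify : ∀ u v su sv → sumAdj d su sv ≡ true → G1Edge (image-of u su) (image-of v sv)
      classify u v (inj₁ (a , _)) (inj₁ (b , _)) e with adj G1 a b in ab
      ... | true  = direct ab
      ... | false with j , hit ← anyF-witness _ e = virtual-edge j a b (∧-conicalˡ _ _ hit)
      classify u v (inj₁ (a , _)) (inj₂ (j , v′ , _)) e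
        with ca , cb ← attachment-cherry a j (br v) (Data.Sum.map proj₁ proj₁ (adj12-cases a j v′ e)) =
        cherry j ca cb
      classify u v (inj₂ (j , u′ , _)) (inj₁ (b , _)) e
        with cb , ca ← attachment-cherry b j (br u) (Data.Sum.map proj₁ proj₁ (adj12-cases b j u′ e)) =
        cherry j ca cb
      classify u v (inj₂ (j , u′ , _)) (inj₂ (k , v′ , _)) e with adj22-cases j k u′ v′ e
      ... | refl , _ = cherry j (collapse-cherry j (br u)) (collapse-cherry j (br v))

      edge-image : ∀ u v → adj G u v ≡ true → G1Edge (image u) (image v)
      edge-image u v uv = classify u v (to u) (to v) (trans (sym (adj-to u v)) uv)

      centre-in-branch : ∀ j i → InBranch i (x1 j) → InBranch i (y1 j) → InBranch i (z j)
      centre-in-branch j i x∈ y∈ =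
        trans (branch-z j) (trans (cong (λ s → z-branch-from j s (representative j)) same)
                                  (trans (sym (branch-x j)) x∈))
        where
        same : xy-same j ≡ true
        same rewrite restrict⇒embed (βx j) i (trans (sym (branch-x j)) x∈)
                   | restrict⇒embed (βy j) i (trans (sym (branch-y j)) y∈) = =M-refl (just (embed i))

      inner-edge : ∀ u v i → br u ≡ just (embed i) → br v ≡ just (embed i) → adj G u v ≡ true →
                   Path G1 (InBranch i) (image u) (image v)
      inner-edge u v i u∈ v∈ uv with edge-image u v uv
      ... | direct ab = edge-path ab (image-in-branch v i v∈)
      ... | cherry j cu cv = cherry-path (x1 j) (y1 j) (z j) (zx j) (zy j) (centre-in-branch j i)
                               (image u) (image v) cu cv (image-in-branch u i u∈) (image-in-branch v i v∈)

      Reached : Fin (2 + m) → Fin (n G1) → Set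
      Reached i a = ∃ λ v → br v ≡ just (embed i) × Path G1 (InBranch i) (image v) a

      -- z j is reached from xG j through the edge x1 j z j, or is the image of
      -- the vertices of its representative leaf
      z-reached : ∀ j i → InBranch i (z j) → Reached i (z j)
      z-reached j i z∈ = go (xy-same j) (representative j) refl (trans (sym (branch-z j)) z∈)
        where
        from-xG : restrict (βx j) ≡ just i → Reached i (z j)
        from-xG x∈ = xG j , restrict⇒embed (βx j) i x∈ , ≡⇒path (image-xG j) ++ᴾ edge-path (xz j) z∈
        go : ∀ s mr → representative j ≡ mr → z-branch-from j s mr ≡ just i → Reached i (z j)
        go true  _        _     x∈   = from-xG x∈
        go false nothing  _     x∈   = from-xG x∈
        go false (just r) found refl =
          leaf-vertex (h r) , leaf-vertex∈ (h r) ,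
          ≡⇒path (image-inside j (h r) _ (slot-z⇒inside (h r) j (representative-slot j found))
                                          (leaf-vertex∈ (h r)))

      branch-reached : ∀ a i → InBranch i a → Reached i a
      branch-reached a i a∈ = reach (T? (not (isZ d a)))
        where
        reach : Dec (T (not (isZ d a))) → Reached i a
        reach (yes p) = from (inj₁ (a , p)) ,
                        restrict⇒embed _ i (trans (sym (branch-kept a p)) a∈) ,
                        ≡⇒path (cong (image-of _) (to-from _))
        reach (no not-kept) with j , refl ← not-kept⇒z a not-kept = z-reached j i a∈

      Realised : Fin (2 + m) → Fin (2 + m) → Set
      Realised i i′ = ∃₂ λ a b → InBranch i a × InBranch i′ b × adj G1 a b ≡ true

      poles-nonadjacent : ∀ i i′ → embed i ≡ zero → embed i′ ≡ suc zero → adj (K2 m) i i′ ≢ true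
      poles-nonadjacent i i′ i≡ i′≡ with refl ← embed-injective i zero i≡
                                       | refl ← embed-injective i′ (suc zero) i′≡ = λ ()

      -- If x1 j and y1 j lie in adjacent branch sets i, i′, then z j lies in one
      -- of them: otherwise x and y are in distinct branch sets and z j went to
      -- a representative leaf, forcing xG j, yG j to be the two poles.
      z-joins : ∀ j i i′ → InBranch i (x1 j) → InBranch i′ (y1 j) → adj (K2 m) i i′ ≡ true →
                InBranch i (z j) ⊎ InBranch i′ (z j)
      z-joins j i i′ x∈ y∈ ii′ =
        Data.Sum.map (trans (branch-z j)) (trans (branch-z j))
                     (go (xy-same j) (representative j) refl refl)
        where
        x≡ : βx j ≡ just (embed i)
        x≡ = restrict⇒embed (βx j) i (trans (sym (branch-x j)) x∈)
        y≡ : βy j ≡ just (embed i′)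
        y≡ = restrict⇒embed (βy j) i′ (trans (sym (branch-y j)) y∈)
        go : ∀ s mr → xy-same j ≡ s → representative j ≡ mr →
             z-branch-from j s mr ≡ just i ⊎ z-branch-from j s mr ≡ just i′
        go true _ same _
          with refl ← embed-injective i i′ (just-injective (trans (sym x≡) (trans (=M⇒≡ same) y≡)))
          = ⊥-elim (adjacent⇒≢ (K2 m) {i} ii′ refl)
        go false nothing  _ _ = inj₁ (trans (sym (branch-x j)) x∈)
        go false (just r) _ found with poles-at-xy j (h r) (slot-z⇒inside (h r) j (representative-slot j found))
        ... | inj₁ x₀ , inj₁ x₁ = ⊥-elim (poles-distinct (trans (sym x₀) x₁))
        ... | inj₂ y₀ , inj₂ y₁ = ⊥-elim (poles-distinct (trans (sym y₀) y₁))
        ... | inj₁ x₀ , inj₂ y₁ =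
          ⊥-elim (poles-nonadjacent i i′ (just-injective (trans (sym x≡) x₀))
                                         (just-injective (trans (sym y≡) y₁)) ii′)
        ... | inj₂ y₀ , inj₁ x₁ =
          ⊥-elim (poles-nonadjacent i′ i (just-injective (trans (sym y≡) y₀))
                                         (just-injective (trans (sym x≡) x₁))
                                    (trans (Graph.sym (K2 m) i′ i) ii′))

      loop : ∀ {i i′ a} → InBranch i a → InBranch i′ a → adj (K2 m) i i′ ≢ true
      loop {i} a∈ a∈′ ii′ with refl ← just-injective (trans (sym a∈) a∈′) =
        adjacent⇒≢ (K2 m) {i} ii′ refl

      cherry-edge : ∀ j i i′ a b → Cherry j a → Cherry j b → InBranch i a → InBranch i′ b →
                    adj (K2 m) i i′ ≡ true → Realised i i′
      cherry-edge j i i′ a b (inj₁ refl) (inj₂ (inj₂ refl)) a∈ b∈ _ = a , b , a∈ , b∈ , xz j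
      cherry-edge j i i′ a b (inj₂ (inj₁ refl)) (inj₂ (inj₂ refl)) a∈ b∈ _ = a , b , a∈ , b∈ , yz j
      cherry-edge j i i′ a b (inj₂ (inj₂ refl)) (inj₁ refl) a∈ b∈ _ = a , b , a∈ , b∈ , zx j
      cherry-edge j i i′ a b (inj₂ (inj₂ refl)) (inj₂ (inj₁ refl)) a∈ b∈ _ = a , b , a∈ , b∈ , zy j
      cherry-edge j i i′ a b (inj₁ refl) (inj₂ (inj₁ refl)) a∈ b∈ ii′ with z-joins j i i′ a∈ b∈ ii′
      ... | inj₁ z∈ = z j , b , z∈ , b∈ , zy j
      ... | inj₂ z∈ = a , z j , a∈ , z∈ , xz j
      cherry-edge j i i′ a b (inj₂ (inj₁ refl)) (inj₁ refl) a∈ b∈ ii′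
        with z-joins j i′ i b∈ a∈ (trans (Graph.sym (K2 m) i′ i) ii′)
      ... | inj₁ z∈ = a , z j , a∈ , z∈ , yz j
      ... | inj₂ z∈ = z j , b , z∈ , b∈ , zx j
      cherry-edge j i i′ a b (inj₁ refl) (inj₁ refl) a∈ b∈ ii′ = ⊥-elim (loop a∈ b∈ ii′)
      cherry-edge j i i′ a b (inj₂ (inj₁ refl)) (inj₂ (inj₁ refl)) a∈ b∈ ii′ = ⊥-elim (loop a∈ b∈ ii′)
      cherry-edge j i i′ a b (inj₂ (inj₂ refl)) (inj₂ (inj₂ refl)) a∈ b∈ ii′ = ⊥-elim (loop a∈ b∈ ii′)

      cross-edge : ∀ u v i i′ → br u ≡ just (embed i) → br v ≡ just (embed i′) → adj G u v ≡ true →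
                   adj (K2 m) i i′ ≡ true → Realised i i′
      cross-edge u v i i′ u∈ v∈ uv ii′ with edge-image u v uv
      ... | direct ab = image u , image v , image-in-branch u i u∈ , image-in-branch v i′ v∈ , ab
      ... | cherry j cu cv =
        cherry-edge j i i′ (image u) (image v) cu cv (image-in-branch u i u∈) (image-in-branch v i′ v∈) ii′

      G1-model : Model (K2 m) G1
      G1-model = projected-model M embed embed-adj record
        { image = image ; branch′ = branch ; image-in-branch = image-in-branch
        ; branch-reached = branch-reached ; inner-edge = inner-edge ; cross-edge = cross-edge }

    piece-minor : ∀ j q → 1 ≤ q → q ≤ count (λ k → slot k == z j) → Model (K2 q) (G2 j)
    piece-minor j (suc q) _ many with e , e-inj , e-slot ← select (λ k → slot k == z j) (suc q) many =
      IntoPiece.piece-model j (suc q) e e-inj (λ r → slot-z⇒inside (e r) j (==⇒≡ (e-slot r))) zero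

    trapped-pole-minor : ∀ P j q → (∀ k → adj (K2 N) P (leaf k) ≡ true) → PoleTrapped P j →
                         1 ≤ q → q + 2 ≤ N → Model (K2 q) (G2 j)
    trapped-pole-minor P j q Pk trap q≥1 big =
      piece-minor j q q≥1 (ℕ.+-cancelʳ-≤ 2 q _ (ℕ.≤-trans big (trapped-pole-count P j Pk trap)))

    -- With both poles free and N ≥ m·q, q ≥ 2, the pigeonhole principle on
    -- slots yields either m leaves with distinct slots (a K_{2,m} minor of G1)
    -- or q leaves sharing a slot, which must then be some z j since slots of
    -- the other kind are distinct (a K_{2,q} minor of piece j).
    free-poles-minor : ∀ m q → 2 ≤ q → m * q ≤ N → PoleFree zero → PoleFree (suc zero) →
                       Model (K2 m) G1 ⊎ ∃ λ j → Model (K2 q) (G2 j)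
    free-poles-minor m q q≥2 big free₀ free₁
      with pigeonhole slot q (ℕ.≤-trans (s≤s z≤n) q≥2) m (λ _ → true)
                      (subst (m * q ≤_) (sym (count-all N)) big)
    ... | inj₂ (h , distinct , _) = inj₁ (IntoG1.G1-model m h distinct free₀ free₁)
    ... | inj₁ (c , many) with isZ d c in c-isZ
    ...   | true with j , hit ← anyF-witness (λ j → z j == c) c-isZ
                 with refl ← ==⇒≡ {a = z j} {b = c} hit =
      inj₂ (j , piece-minor j q (ℕ.≤-trans (s≤s z≤n) q≥2) many)
    ...   | false with e , e-inj , e-slot ← select (λ k → slot k == c) 2 (ℕ.≤-trans q≥2 many)
      with () ← e-inj zero (suc zero)
                  (slot-injective (e zero) (e (suc zero))
                    (trans (==⇒≡ (e-slot zero)) (sym (==⇒≡ (e-slot (suc zero)))))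
                    (trans (cong (isZ d) (==⇒≡ (e-slot zero))) c-isZ))

    poles-minor : ∀ m q → 2 ≤ m → 2 ≤ q → m * q ≤ N →
                  Model (K2 m) G1 ⊎ ∃ λ j → Model (K2 q) (G2 j)
    poles-minor m q m≥2 q≥2 big = by-poles (pole-trapped? zero) (pole-trapped? (suc zero))
      where
      q≥1 : 1 ≤ q
      q≥1 = ℕ.≤-trans (s≤s z≤n) q≥2
      q+2≤N : q + 2 ≤ N
      q+2≤N = ℕ.≤-trans (q+2≤m*q m q m≥2 q≥2) big
      by-poles : PoleFree zero ⊎ ∃ (PoleTrapped zero) → PoleFree (suc zero) ⊎ ∃ (PoleTrapped (suc zero)) →
                 Model (K2 m) G1 ⊎ ∃ λ j → Model (K2 q) (G2 j)
      by-poles (inj₂ (j , trap)) _ = inj₂ (j , trapped-pole-minor zero j q pole-leaf-adj trap q≥1 q+2≤N)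
      by-poles (inj₁ _) (inj₂ (j , trap)) =
        inj₂ (j , trapped-pole-minor (suc zero) j q pole′-leaf-adj trap q≥1 q+2≤N)
      by-poles (inj₁ free₀) (inj₁ free₁) = free-poles-minor m q q≥2 big free₀ free₁

  -- Without pieces, G is G1 and the leaves have pairwise distinct slots.
  no-pieces-minor : (Fin t → ⊥) → ∀ m q → 1 ≤ q → Model (K2 (m * q)) G → Model (K2 m) G1
  no-pieces-minor no-piece m q q≥1 M =
    IntoG1.G1-model m (λ r → Data.Fin.inject≤ r m≤N) slots-distinct
      (λ j → ⊥-elim (no-piece j)) (λ j → ⊥-elim (no-piece j))
    where
    open Leaves (m * q) M
    m≤N : m ≤ m * q
    m≤N = ℕ.≤-trans (ℕ.≤-reflexive (sym (ℕ.*-identityʳ m))) (ℕ.*-monoʳ-≤ m q≥1)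
    slots-distinct : ∀ a b → slot (Data.Fin.inject≤ a m≤N) ≡ slot (Data.Fin.inject≤ b m≤N) → a ≡ b
    slots-distinct a b same = Fin.inject≤-injective m≤N m≤N a b
      (slot-injective _ _ same (anyF-none _ (λ j → ⊥-elim (no-piece j))))

  -- With a piece j₀: if q = 1 then G2 j₀ itself has a K_{2,1} minor, and if
  -- m = 1 then G1 has one (both at a degree-two vertex).  Otherwise
  -- N = m·q ≥ q + 2, and either a pole is trapped in some piece or both are
  -- free.
  some-piece-minor : Fin t → ∀ m q → 1 ≤ m → 1 ≤ q → Model (K2 (m * q)) G →
                     Model (K2 m) G1 ⊎ ∃ λ j → Model (K2 q) (G2 j)
  some-piece-minor j₀ m (suc zero) _ _ _ =
    inj₂ (j₀ , DegreeTwo.K₂,₁-model (G2 j₀) (w j₀) (x2 j₀) (y2 j₀) (deg2 j₀))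
  some-piece-minor j₀ (suc zero) q _ _ _ =
    inj₁ (DegreeTwo.K₂,₁-model G1 (z j₀) (x1 j₀) (y1 j₀) (deg1 j₀))
  some-piece-minor j₀ m@(suc (suc _)) q@(suc (suc _)) _ _ M =
    Leaves.poles-minor (m * q) M m q (s≤s (s≤s z≤n)) (s≤s (s≤s z≤n)) ℕ.≤-refl

  K2-minor-in-part : ∀ m q → 1 ≤ m → 1 ≤ q → Model (K2 (m * q)) G →
                     Model (K2 m) G1 ⊎ ∃ λ j → Model (K2 q) (G2 j)
  K2-minor-in-part m q m≥1 q≥1 M with fin-or-empty t
  ... | inj₁ no-piece = inj₁ (no-pieces-minor no-piece m q q≥1 M)
  ... | inj₂ j₀       = some-piece-minor j₀ m q m≥1 q≥1 M

lemma6p2 : (m n : ℕ) → 1 ≤ m → 1 ≤ n → (𝒢₁ 𝒢₂ : Class) →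
    (∀ G → 𝒢₁ G → ¬ HasMinor G (K2 m)) →
    (∀ G → 𝒢₂ G → ¬ HasMinor G (K2 n)) →
    ∀ G → (𝒢₁ ⊕ 𝒢₂) G → ¬ HasMinor G (K2 (m * n))
lemma6p2 m n m≥1 n≥1 𝒢₁ 𝒢₂ no-K2m no-K2n G (d , G1∈𝒢₁ , G2∈𝒢₂ , iso) M
  with TwoSum.K2-minor-in-part d G iso m n m≥1 n≥1 M
... | inj₁ M₁       = no-K2m (TwoSumData.G1 d) G1∈𝒢₁ M₁
... | inj₂ (j , M₂) = no-K2n (TwoSumData.G2 d j) (G2∈𝒢₂ j) M₂
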